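{- Let $(G,\alpha)$ be an edge-labeled graph and $(G',\alpha')$ a subdivision of $(G,\alpha)$. For any $u,v\in V(G)$, $$\bigcap_{P\in\mathcal{P}_G(u,v)}\alpha(P)=\bigcap_{P'\in\mathcal{P}_{G'}(u,v)}\alpha'(P').$$
   Context: Edge-labelings are over a commutative ring $R$ with unity: an edge-labeling assigns to each edge an ideal of $R$. A path has no repeated vertices; $\mathcal{P}_H(u,v)$ is the set of all paths from $u$ to $v$ in $H$, and $\alpha(P)$ is the sum of the ideals labeling the edges of $P$. Subdividing an edge $uv$ means replacing it by a path $u,w,v$ through a new vertex $w$; a subdivision of $G$ is a graph obtained by successive edge subdivisions. A subdivision of an edge-labeled graph $(G,\alpha)$ is an edge-labeled graph $(G',\alpha')$ where $G'$ is a subdivision of $G$, every edge of $G'$ that is an edge of $G$ keeps its label, and every edge of $G'$ created by subdividing an edge $e$ of $G$ receives the label $\alpha(e)$. -}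

module Defs where

open import Level using (Level; _⊔_; Lift) renaming (suc to lsuc)
open import Algebra.Bundles using (CommutativeRing)
open import Data.Nat using (ℕ) renaming (suc to sucℕ)
open import Data.Fin using (Fin; zero; suc; _≟_)
open import Data.Product using (_×_; _,_; proj₁; proj₂; Σ; ∃)
open import Data.Sum using (_⊎_)
open import Data.List using (List; []; _∷_; map)
open import Data.List.Relation.Unary.Unique.Propositional using (Unique)
open import Relation.Nullary using (¬_; yes; no)
open import Relation.Binary.PropositionalEquality using (_≡_; _≢_)

record Ideal {c ℓ} (R : CommutativeRing c ℓ) (p : Level) : Set (c ⊔ ℓ ⊔ lsuc p) where
  open CommutativeRing R
  field
    _∈I       : Carrier → Set p
    ∈-resp-≈  : ∀ {x y} → x ≈ y → x ∈I → y ∈I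
    0∈        : 0# ∈I
    +-closed  : ∀ {x y} → x ∈I → y ∈I → (x + y) ∈I
    *-closed  : ∀ r {x} → x ∈I → (r * x) ∈I

InSum : ∀ {c ℓ p} (R : CommutativeRing c ℓ) → List (Ideal R p) →
        CommutativeRing.Carrier R → Set (c ⊔ ℓ ⊔ p)
InSum {c} {ℓ} {p} R [] x = Lift (c ⊔ p) (CommutativeRing._≈_ R x (CommutativeRing.0# R))
InSum R (I ∷ Is) x =
  Σ (CommutativeRing.Carrier R) λ a → Σ (CommutativeRing.Carrier R) λ b →
    (Ideal._∈I I a) × InSum R Is b × CommutativeRing._≈_ R x (CommutativeRing._+_ R a b)

-- Finite graphs: vertices Fin n, edges Fin m, each edge with two ends
-- (undirected: the order of the ends is irrelevant).

record Graph : Set where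
  field
    n    : ℕ
    m    : ℕ
    ends : Fin m → Fin n × Fin n

open Graph public

Joins : (G : Graph) → Fin (m G) → Fin (n G) → Fin (n G) → Set
Joins G e u w = (ends G e ≡ (u , w)) ⊎ (ends G e ≡ (w , u))

IsSimple : Graph → Set
IsSimple G =
  (∀ e → proj₁ (ends G e) ≢ proj₂ (ends G e)) ×
  (∀ e f → Joins G f (proj₁ (ends G e)) (proj₂ (ends G e)) → e ≡ f)

data Walk (G : Graph) : Fin (n G) → Fin (n G) → Set where
  nil  : ∀ {u} → Walk G u u
  cons : ∀ {u w v} (e : Fin (m G)) → Joins G e u w → Walk G w v → Walk G u v

walkVertices : ∀ {G u v} → Walk G u v → List (Fin (n G))
walkVertices {u = u} nil = u ∷ []
walkVertices {u = u} (cons e _ P) = u ∷ walkVertices P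

walkEdges : ∀ {G u v} → Walk G u v → List (Fin (m G))
walkEdges nil = []
walkEdges (cons e _ P) = e ∷ walkEdges P

IsPath : ∀ {G u v} → Walk G u v → Set
IsPath P = Unique (walkVertices P)

record LGraph {c ℓ} (R : CommutativeRing c ℓ) (p : Level) : Set (c ⊔ ℓ ⊔ lsuc p) where
  field
    graph : Graph
    α     : Fin (m graph) → Ideal R p

open LGraph public

InLabel : ∀ {c ℓ p} {R : CommutativeRing c ℓ} (H : LGraph R p) {u v} →
          Walk (graph H) u v → CommutativeRing.Carrier R → Set (c ⊔ ℓ ⊔ p)
InLabel {R = R} H P x = InSum R (map (α H) (walkEdges P)) x

InPathIntersection : ∀ {c ℓ p} {R : CommutativeRing c ℓ} (H : LGraph R p) →
  Fin (n (graph H)) → Fin (n (graph H)) → CommutativeRing.Carrier R → Set (c ⊔ ℓ ⊔ p)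
InPathIntersection H u v x =
  ∀ (P : Walk (graph H) u v) → IsPath P → InLabel H P x

-- Subdividing one edge e = (a,b): a new vertex w (= zero, old vertices are
-- shifted by suc), edge e becomes a–w and a new edge (= zero, old edges
-- shifted by suc) w–b is added.

subdivideGraph : (G : Graph) → Fin (m G) → Graph
subdivideGraph G e = record
  { n = sucℕ (n G)
  ; m = sucℕ (m G)
  ; ends = ends'
  }
  where
  ends' : Fin (sucℕ (m G)) → Fin (sucℕ (n G)) × Fin (sucℕ (n G))
  ends' zero = (zero , suc (proj₂ (ends G e)))
  ends' (suc j) with j ≟ e
  ... | yes _ = (suc (proj₁ (ends G e)) , zero)
  ... | no  _ = (suc (proj₁ (ends G j)) , suc (proj₂ (ends G j)))

subdivide : ∀ {c ℓ p} {R : CommutativeRing c ℓ} (H : LGraph R p) →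
            Fin (m (graph H)) → LGraph R p
subdivide H e = record
  { graph = subdivideGraph (graph H) e
  ; α = α'
  }
  where
  α' : Fin (sucℕ (m (graph H))) → Ideal _ _
  α' zero    = α H e
  α' (suc j) = α H j

-- Subdivision G H ι : H is obtained from G by successive edge subdivisions,
-- and ι : V(G) → V(H) is the resulting identification of the old vertices.
data Subdivision {c ℓ p} {R : CommutativeRing c ℓ} (G : LGraph R p) :
     (H : LGraph R p) → (Fin (n (graph G)) → Fin (n (graph H))) → Set (c ⊔ ℓ ⊔ lsuc p) where
  base : Subdivision G G (λ u → u)
  step : ∀ {H ι} → Subdivision G H ι → (e : Fin (m (graph H))) →
         Subdivision G (subdivide H e) (λ u → suc (ι u))

{-# OPTIONS --safe #-}
-- A sum of ideals only grows with its list of summands, and every walk contains a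
-- path using a subset of its edges, so the intersection over paths is the
-- intersection over all walks.  Subdividing an edge e maps walks to walks by
-- traversing e as its two halves, and back by contracting the new vertex (a step
-- into it and straight back out through the same half is simply dropped); both
-- maps only shrink the set of labels, each half of e being labeled α(e).
module Submission where

open import Defs
open import Level using (Level; lift)
open import Algebra.Bundles using (CommutativeRing)
import Algebra.Properties.CommutativeSemigroup as CommutativeSemigroupProperties
open import Data.Fin using (Fin; zero; suc; _≟_)
open import Data.Product as Product using (_×_; _,_; proj₁; proj₂; Σ-syntax)
open import Data.Sum as Sum using (_⊎_; inj₁; inj₂)
open import Data.List using (List; []; _∷_; map)
open import Data.List.Membership.Propositional using (_∈_)
open import Data.List.Relation.Unary.Any using (here; there; any?)
open import Data.List.Relation.Unary.All using ([])
open import Data.List.Relation.Unary.All.Properties using (¬Any⇒All¬)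
open import Data.List.Relation.Unary.AllPairs using ([]; _∷_)
open import Data.List.Relation.Binary.Subset.Propositional using (_⊆_)
open import Data.List.Relation.Binary.Subset.Propositional.Properties
  using (⊆-refl; ⊆-trans; xs⊆x∷xs; ∷⁺ʳ; ∈-∷⁺ʳ; map⁺)
open import Function using (_∘_; id)
open import Relation.Nullary using (¬_; yes; no; contradiction)
open import Relation.Binary.PropositionalEquality using (_≡_; _≢_; refl; sym; cong)

module _ {c ℓ p : Level} {R : CommutativeRing c ℓ} where
  open CommutativeRing R renaming (refl to ≈-refl; sym to ≈-sym; trans to ≈-trans)
  open CommutativeSemigroupProperties +-commutativeSemigroup using (interchange)

  InSum-0# : ∀ (Is : List (Ideal R p)) → InSum R Is 0#
  InSum-0# []       = lift ≈-refl
  InSum-0# (I ∷ Is) = 0# , 0# , Ideal.0∈ I , InSum-0# Is , ≈-sym (+-identityʳ 0#)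

  InSum-resp-≈ : ∀ (Is : List (Ideal R p)) {x y} → x ≈ y → InSum R Is x → InSum R Is y
  InSum-resp-≈ []       x≈y (lift x≈0) = lift (≈-trans (≈-sym x≈y) x≈0)
  InSum-resp-≈ (I ∷ Is) x≈y (a , b , a∈I , b∈Is , x≈a+b) =
    a , b , a∈I , b∈Is , ≈-trans (≈-sym x≈y) x≈a+b

  InSum-+ : ∀ (Is : List (Ideal R p)) {x y} → InSum R Is x → InSum R Is y → InSum R Is (x + y)
  InSum-+ [] (lift x≈0) (lift y≈0) = lift (≈-trans (+-cong x≈0 y≈0) (+-identityʳ 0#))
  InSum-+ (I ∷ Is) (a , b , a∈I , b∈Is , x≈a+b) (a′ , b′ , a′∈I , b′∈Is , y≈a′+b′) =
    a + a′ , b + b′ , Ideal.+-closed I a∈I a′∈I , InSum-+ Is b∈Is b′∈Is ,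
    ≈-trans (+-cong x≈a+b y≈a′+b′) (interchange a b a′ b′)

  InSum-∈ : ∀ {I : Ideal R p} {Is x} → I ∈ Is → Ideal._∈I I x → InSum R Is x
  InSum-∈ {Is = I ∷ Is} {x = x} (here refl) x∈I = x , 0# , x∈I , InSum-0# Is , ≈-sym (+-identityʳ x)
  InSum-∈ {Is = I ∷ Is} {x = x} (there I∈Is) x∈I =
    0# , x , Ideal.0∈ I , InSum-∈ I∈Is x∈I , ≈-sym (+-identityˡ x)

  InSum-mono : ∀ {Is Js : List (Ideal R p)} {x} → Is ⊆ Js → InSum R Is x → InSum R Js x
  InSum-mono {[]}     {Js} _ (lift x≈0) = InSum-resp-≈ Js (≈-sym x≈0) (InSum-0# Js)
  InSum-mono {I ∷ Is} {Js} I∷Is⊆Js (a , b , a∈I , b∈Is , x≈a+b) =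
    InSum-resp-≈ Js (≈-sym x≈a+b)
      (InSum-+ Js (InSum-∈ (I∷Is⊆Js (here refl)) a∈I)
                  (InSum-mono (⊆-trans (xs⊆x∷xs Is I) I∷Is⊆Js) b∈Is))

module _ {G : Graph} where

  suffixFrom : ∀ {u w v} (P : Walk G w v) → u ∈ walkVertices P → Walk G u v
  suffixFrom nil          (here refl)  = nil
  suffixFrom (cons e j P) (here refl)  = cons e j P
  suffixFrom (cons _ _ P) (there u∈P) = suffixFrom P u∈P

  suffixFrom-edges : ∀ {u w v} (P : Walk G w v) (u∈P : u ∈ walkVertices P) →
                     walkEdges (suffixFrom P u∈P) ⊆ walkEdges P
  suffixFrom-edges nil          (here refl)  = ⊆-refl
  suffixFrom-edges (cons e j P) (here refl)  = ⊆-refl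
  suffixFrom-edges (cons e _ P) (there u∈P) = ⊆-trans (suffixFrom-edges P u∈P) (xs⊆x∷xs _ e)

  suffixFrom-isPath : ∀ {u w v} (P : Walk G w v) (u∈P : u ∈ walkVertices P) →
                      IsPath P → IsPath (suffixFrom P u∈P)
  suffixFrom-isPath nil          (here refl) P-path        = P-path
  suffixFrom-isPath (cons e j P) (here refl) P-path        = P-path
  suffixFrom-isPath (cons _ _ P) (there u∈P) (_ ∷ P-path) = suffixFrom-isPath P u∈P P-path

  walk⇒path : ∀ {u v} (W : Walk G u v) →
              Σ[ P ∈ Walk G u v ] IsPath P × walkEdges P ⊆ walkEdges W
  walk⇒path nil = nil , [] ∷ [] , ⊆-refl
  walk⇒path {u} (cons e j W) with walk⇒path W
  ... | P , P-path , P⊆W with any? (u ≟_) (walkVertices P)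
  ...   | yes u∈P = suffixFrom P u∈P , suffixFrom-isPath P u∈P P-path ,
                    ⊆-trans (suffixFrom-edges P u∈P) (⊆-trans P⊆W (xs⊆x∷xs _ e))
  ...   | no  u∉P = cons e j P , ¬Any⇒All¬ _ u∉P ∷ P-path , ∷⁺ʳ e P⊆W

module _ {c ℓ p : Level} {R : CommutativeRing c ℓ} where

  labels : ∀ (H : LGraph R p) {u v} → Walk (graph H) u v → List (Ideal R p)
  labels H W = map (α H) (walkEdges W)

  WalkReduction : (H₁ : LGraph R p) (u₁ v₁ : Fin (n (graph H₁)))
                  (H₂ : LGraph R p) (u₂ v₂ : Fin (n (graph H₂))) → Set _
  WalkReduction H₁ u₁ v₁ H₂ u₂ v₂ =
    (W : Walk (graph H₁) u₁ v₁) → Σ[ W′ ∈ Walk (graph H₂) u₂ v₂ ] labels H₂ W′ ⊆ labels H₁ W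

  InPathIntersection-reduce : ∀ {H₁ u₁ v₁ H₂ u₂ v₂ x} → WalkReduction H₁ u₁ v₁ H₂ u₂ v₂ →
                              InPathIntersection H₂ u₂ v₂ x → InPathIntersection H₁ u₁ v₁ x
  InPathIntersection-reduce {H₂ = H₂} reduce x∈⋂ W _ with reduce W
  ... | W′ , W′⊆W with walk⇒path W′
  ... | P , P-path , P⊆W′ = InSum-mono (⊆-trans (map⁺ (α H₂) P⊆W′) W′⊆W) (x∈⋂ P P-path)

module SubdividedEdge {c ℓ p : Level} {R : CommutativeRing c ℓ} (H : LGraph R p) (e : Fin (m (graph H))) where

  private
    G : Graph
    G = graph H

    H′ : LGraph R p
    H′ = subdivide H e

    G′ : Graph
    G′ = graph H′

    a b : Fin (n G)
    a = proj₁ (ends G e)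
    b = proj₂ (ends G e)

  ends-first-half : ends G′ (suc e) ≡ (suc a , zero)
  ends-first-half with e ≟ e
  ... | yes _   = refl
  ... | no e≢e = contradiction refl e≢e

  joins-old : ∀ {f x y} → f ≢ e → Joins G f x y → Joins G′ (suc f) (suc x) (suc y)
  joins-old {f} f≢e j with f ≟ e
  ... | yes f≡e = contradiction f≡e f≢e
  ... | no _    = Sum.map (cong (Product.map suc suc)) (cong (Product.map suc suc)) j

  joins-e⇒endpoints : ∀ {x y} → Joins G e x y → (x ≡ a × y ≡ b) ⊎ (x ≡ b × y ≡ a)
  joins-e⇒endpoints (inj₁ refl) = inj₁ (refl , refl)
  joins-e⇒endpoints (inj₂ refl) = inj₂ (refl , refl)

  joins′-old-old : ∀ {f x y} → Joins G′ f (suc x) (suc y) →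
                   Σ[ f₀ ∈ Fin (m G) ] f ≡ suc f₀ × Joins G f₀ x y
  joins′-old-old {zero} (inj₁ ())
  joins′-old-old {zero} (inj₂ ())
  joins′-old-old {suc f₀} j with f₀ ≟ e
  joins′-old-old {suc f₀} (inj₁ ())    | yes _
  joins′-old-old {suc f₀} (inj₂ ())    | yes _
  joins′-old-old {suc f₀} (inj₁ refl) | no _ = f₀ , refl , inj₁ refl
  joins′-old-old {suc f₀} (inj₂ refl) | no _ = f₀ , refl , inj₂ refl

  joins′-old-new : ∀ {f x} → Joins G′ f (suc x) zero → α H′ f ≡ α H e × (x ≡ a ⊎ x ≡ b)
  joins′-old-new {zero} (inj₁ ())
  joins′-old-new {zero} (inj₂ refl) = refl , inj₂ refl
  joins′-old-new {suc f₀} j with f₀ ≟ e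
  joins′-old-new {suc f₀} (inj₁ refl) | yes refl = refl , inj₁ refl
  joins′-old-new {suc f₀} (inj₂ ())   | yes _
  joins′-old-new {suc f₀} (inj₁ ())   | no _
  joins′-old-new {suc f₀} (inj₂ ())   | no _

  ¬joins′-new-new : ∀ {f} → ¬ Joins G′ f zero zero
  ¬joins′-new-new {zero} (inj₁ ())
  ¬joins′-new-new {zero} (inj₂ ())
  ¬joins′-new-new {suc f₀} j with f₀ ≟ e
  ¬joins′-new-new {suc f₀} (inj₁ ()) | yes _
  ¬joins′-new-new {suc f₀} (inj₂ ()) | yes _
  ¬joins′-new-new {suc f₀} (inj₁ ()) | no _
  ¬joins′-new-new {suc f₀} (inj₂ ()) | no _

  joins-e-or-equal : ∀ {x y} → x ≡ a ⊎ x ≡ b → y ≡ a ⊎ y ≡ b → Joins G e x y ⊎ x ≡ y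
  joins-e-or-equal (inj₁ refl) (inj₁ refl) = inj₂ refl
  joins-e-or-equal (inj₁ refl) (inj₂ refl) = inj₁ (inj₁ refl)
  joins-e-or-equal (inj₂ refl) (inj₁ refl) = inj₁ (inj₂ refl)
  joins-e-or-equal (inj₂ refl) (inj₂ refl) = inj₂ refl

  expand : ∀ {u v} → WalkReduction H u v H′ (suc u) (suc v)
  expand nil = nil , ⊆-refl
  expand (cons f j W) with expand W | f ≟ e
  ... | W′ , W′⊆W | no f≢e  = cons (suc f) (joins-old f≢e j) W′ , ∷⁺ʳ (α H f) W′⊆W
  ... | W′ , W′⊆W | yes refl with joins-e⇒endpoints j
  ...   | inj₁ (refl , refl) =
          cons (suc e) (inj₁ ends-first-half) (cons zero (inj₁ refl) W′) ,
          ∈-∷⁺ʳ (here refl) (∷⁺ʳ (α H e) W′⊆W)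
  ...   | inj₂ (refl , refl) =
          cons zero (inj₂ refl) (cons (suc e) (inj₂ ends-first-half) W′) ,
          ∈-∷⁺ʳ (here refl) (∷⁺ʳ (α H e) W′⊆W)

  contract : ∀ {u v} → WalkReduction H′ (suc u) (suc v) H u v
  contract nil = nil , ⊆-refl
  contract (cons {w = suc _} f j W) with joins′-old-old {f} j | contract W
  ... | f₀ , refl , j₀ | V , V⊆W = cons f₀ j₀ V , ∷⁺ʳ (α H f₀) V⊆W
  contract (cons {w = zero} f j (cons {w = zero} g k W)) = contradiction k (¬joins′-new-new {g})
  contract (cons {w = zero} f j (cons {w = suc _} g k W))
    with joins′-old-new {f} j | joins′-old-new {g} (Sum.swap k) | contract W
  ... | αf≡αe , u∈e | _ , y∈e | V , V⊆W with joins-e-or-equal u∈e y∈e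
  ...   | inj₁ j₀   = cons e j₀ V , ∈-∷⁺ʳ (here (sym αf≡αe)) (there ∘ there ∘ V⊆W)
  ...   | inj₂ refl = V , there ∘ there ∘ V⊆W

  InPathIntersection-subdivide : ∀ u v x →
    (InPathIntersection H u v x → InPathIntersection H′ (suc u) (suc v) x) ×
    (InPathIntersection H′ (suc u) (suc v) x → InPathIntersection H u v x)
  InPathIntersection-subdivide u v x =
    InPathIntersection-reduce contract , InPathIntersection-reduce expand

InPathIntersection-subdivision :
  ∀ {c ℓ p} {R : CommutativeRing c ℓ} {G G′ : LGraph R p} {ι} → Subdivision G G′ ι →
  ∀ u v x → (InPathIntersection G u v x → InPathIntersection G′ (ι u) (ι v) x) ×
            (InPathIntersection G′ (ι u) (ι v) x → InPathIntersection G u v x)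
InPathIntersection-subdivision base u v x = id , id
InPathIntersection-subdivision (step {ι = ι} s e) u v x
  with InPathIntersection-subdivision s u v x
     | SubdividedEdge.InPathIntersection-subdivide _ e (ι u) (ι v) x
... | to , from | to′ , from′ = to′ ∘ to , from ∘ from′

lemma3p6 : ∀ {c ℓ p} (R : CommutativeRing c ℓ) (G G' : LGraph R p)
             (ι : Fin (n (graph G)) → Fin (n (graph G'))) →
             IsSimple (graph G) → Subdivision G G' ι →
             ∀ (u v : Fin (n (graph G))) (x : CommutativeRing.Carrier R) →
             (InPathIntersection G u v x → InPathIntersection G' (ι u) (ι v) x) ×
             (InPathIntersection G' (ι u) (ι v) x → InPathIntersection G u v x)
lemma3p6 R G G' ι _ = InPathIntersection-subdivision
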